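{- Let $(\alpha_j)_{j\geq 1}$ be a sequence of pairwise distinct complex numbers. For each $n \geq 1$ write uniquely $n = (1+2+\cdots+m_n) + j_n$ with integers $m_n \geq 0$ and $1 \leq j_n \leq m_n+1$, and set $i_n = m_n + 1 - j_n$. Define polynomials by $P_0(z)=1$ and $P_n(z) = (z-\alpha_{j_n})P_{n-1}(z)$ for $n \geq 1$. Then for every $n \geq 1$ we have $P_{n-1}^{(i_n)}(\alpha_{j_n}) \neq 0$, and $P_l^{(i_n)}(\alpha_{j_n}) = 0$ for all $l \geq n$.
   Context: $P^{(i)}$ denotes the $i$-th derivative of the polynomial $P$, with $P^{(0)}=P$. -}

module Defs where

open import Level using (_⊔_)
open import Algebra.Bundles using (CommutativeRing)
open import Data.Nat using (ℕ; zero; suc; _≤_; _≤?_) renaming (_+_ to _+ℕ_)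
open import Data.Product using (_×_; _,_; proj₁; proj₂)
open import Data.List using (List; []; _∷_)
open import Data.Sum using (_⊎_)
open import Relation.Nullary using (¬_; yes; no)
open import Relation.Binary.PropositionalEquality using (_≢_)

tri : ℕ → ℕ
tri zero = zero
tri (suc m) = suc m +ℕ tri m

-- For n ≥ 1, mj n = (m_n , j_n) with n = tri m_n + j_n and 1 ≤ j_n ≤ m_n + 1.
-- (mj 0 is a dummy value and is never used.)
mj : ℕ → ℕ × ℕ
mj zero = (zero , zero)
mj (suc zero) = (zero , 1)
mj (suc (suc n)) with mj (suc n)
... | (m , j) with j ≤? m
...   | yes _ = (m , suc j)
...   | no _  = (suc m , 1)

jIdx : ℕ → ℕ
jIdx n = proj₂ (mj n)

-- Polynomials over a commutative ring, as coefficient lists (constant term first).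
module Poly {c ℓ} (R : CommutativeRing c ℓ) where
  open CommutativeRing R

  Pol : Set c
  Pol = List Carrier

  _·ₙ_ : ℕ → Carrier → Carrier
  zero ·ₙ a = 0#
  suc k ·ₙ a = a + (k ·ₙ a)

  _+ₚ_ : Pol → Pol → Pol
  [] +ₚ q = q
  (a ∷ p) +ₚ [] = a ∷ p
  (a ∷ p) +ₚ (b ∷ q) = (a + b) ∷ (p +ₚ q)

  scale : Carrier → Pol → Pol
  scale a [] = []
  scale a (b ∷ p) = (a * b) ∷ scale a p

  mulLin : Carrier → Pol → Pol
  mulLin a p = (0# ∷ p) +ₚ scale (- a) p

  eval : Pol → Carrier → Carrier
  eval [] x = 0#
  eval (b ∷ p) x = b + x * eval p x

  derivFrom : ℕ → Pol → Pol
  derivFrom k [] = []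
  derivFrom k (b ∷ p) = (k ·ₙ b) ∷ derivFrom (suc k) p

  deriv : Pol → Pol
  deriv [] = []
  deriv (b ∷ p) = derivFrom 1 p

  derivN : ℕ → Pol → Pol
  derivN zero p = p
  derivN (suc i) p = deriv (derivN i p)

  P : (ℕ → Carrier) → ℕ → Pol
  P α zero = 1# ∷ []
  P α (suc n) = mulLin (α (jIdx (suc n))) (P α n)

  -- standing hypotheses on the coefficient ring (satisfied by ℂ)
  IntegralDomain : Set (c ⊔ ℓ)
  IntegralDomain = ∀ a b → a * b ≈ 0# → (a ≈ 0#) ⊎ (b ≈ 0#)

  CharZero : Set ℓ
  CharZero = ∀ k → ¬ (suc k ·ₙ 1# ≈ 0#)

  PairwiseDistinct : (ℕ → Carrier) → Set ℓ
  PairwiseDistinct α = ∀ a b → 1 ≤ a → 1 ≤ b → a ≢ b → ¬ (α a ≈ α b)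

{-# OPTIONS --safe #-}
-- Fix j and a = α_j, and let c_l count the k ≤ l with j_k = j, i.e. the factors z − a of P_l.
-- The Leibniz rule ((z − b)Q)^(i+1) = (z − b)Q^(i+1) + (i+1)Q^(i) shows by induction on l that
-- a is a root of P_l of exact order c_l: P_l^(i)(a) = 0 for i < c_l and P_l^(c_l)(a) ≠ 0.
-- (The non-vanishing uses that the α are distinct, that there are no zero divisors and that
-- i+1 ≠ 0.) Row m of the triangle n = 1 + ⋯ + m + j lists j = 1, …, m+1, so the value j appears
-- once in each row m ≥ j − 1; hence c_{n−1} = m + 1 − j = i_n, c_n = i_n + 1, and c_l only grows.
module Submission where

open import Defs
open import Algebra.Bundles using (CommutativeRing)
open import Data.Nat
  using (ℕ; zero; suc; _∸_; _≤_; _<_; _≤?_; _≟_; z≤n; s≤s; _≤′_; ≤′-reflexive; ≤′-step)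
  renaming (_+_ to _+ℕ_)
open import Data.List using ([]; _∷_)
open import Data.Product using (_×_; _,_; proj₁; proj₂)
open import Data.Sum using (inj₁; inj₂)
open import Relation.Binary.Bundles using (Setoid)
import Relation.Binary.Reasoning.Setoid
open import Relation.Binary.PropositionalEquality as ≡ using (_≡_)
open import Relation.Nullary using (¬_; yes; no)

module Enumeration where
  open import Data.Nat.Properties
  open import Relation.Binary.PropositionalEquality
  open import Relation.Nullary.Negation using (contradiction)

  mj-step-≤ : ∀ k {m j} → mj (suc k) ≡ (m , j) → j ≤ m → mj (suc (suc k)) ≡ (m , suc j)
  mj-step-≤ k {m} {j} eq j≤m rewrite eq with j ≤? m
  ... | yes _ = refl
  ... | no j≰m = contradiction j≤m j≰m

  mj-step-≰ : ∀ k {m j} → mj (suc k) ≡ (m , j) → ¬ j ≤ m → mj (suc (suc k)) ≡ (suc m , 1)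
  mj-step-≰ k {m} {j} eq j≰m rewrite eq with j ≤? m
  ... | yes j≤m = contradiction j≤m j≰m
  ... | no _ = refl

  mj-tri : ∀ m k → k ≤ m → mj (suc (tri m +ℕ k)) ≡ (m , suc k)
  mj-tri zero zero _ = refl
  mj-tri (suc m) zero _ rewrite +-identityʳ (tri (suc m)) | +-comm m (tri m) =
    mj-step-≰ (tri m +ℕ m) (mj-tri m m ≤-refl) 1+n≰n
  mj-tri m (suc k) k<m rewrite +-suc (tri m) k =
    mj-step-≤ (tri m +ℕ k) (mj-tri m k (<⇒≤ k<m)) k<m

  jIdx-tri : ∀ m k → k ≤ m → jIdx (suc (tri m +ℕ k)) ≡ suc k
  jIdx-tri m k k≤m = cong proj₂ (mj-tri m k k≤m)

  jIdx-pos : ∀ n → 1 ≤ jIdx (suc n)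
  jIdx-pos zero = s≤s z≤n
  jIdx-pos (suc n) with mj (suc n)
  ... | (m , j) with j ≤? m
  ...   | yes _ = s≤s z≤n
  ...   | no _ = s≤s z≤n

  occurrences : ℕ → ℕ → ℕ
  occurrences j zero = zero
  occurrences j (suc l) with jIdx (suc l) ≟ j
  ... | yes _ = suc (occurrences j l)
  ... | no _ = occurrences j l

  occurrences-hit : ∀ j l → jIdx (suc l) ≡ j → occurrences j (suc l) ≡ suc (occurrences j l)
  occurrences-hit j l hit with jIdx (suc l) ≟ j
  ... | yes _ = refl
  ... | no miss = contradiction hit miss

  occurrences-miss : ∀ j l → jIdx (suc l) ≢ j → occurrences j (suc l) ≡ occurrences j l
  occurrences-miss j l miss with jIdx (suc l) ≟ j
  ... | yes hit = contradiction hit miss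
  ... | no _ = refl

  occurrences-mono : ∀ j {l l′} → l ≤ l′ → occurrences j l ≤ occurrences j l′
  occurrences-mono j l≤l′ = along (≤⇒≤′ l≤l′)
    where
    along : ∀ {l l′} → l ≤′ l′ → occurrences j l ≤ occurrences j l′
    along (≤′-reflexive refl) = ≤-refl
    along {l′ = suc l′} (≤′-step l≤′l′) with jIdx (suc l′) ≟ j
    ... | yes _ = m≤n⇒m≤1+n (along l≤′l′)
    ... | no _ = along l≤′l′

  occurrences-row-before : ∀ j m k → k < j → k ≤ suc m → occurrences j (tri m +ℕ k) ≡ occurrences j (tri m)
  occurrences-row-before j m zero _ _ = cong (occurrences j) (+-identityʳ (tri m))
  occurrences-row-before j m (suc k) k<j (s≤s k≤m) rewrite +-suc (tri m) k = begin
    occurrences j (suc (tri m +ℕ k)) ≡⟨ occurrences-miss j (tri m +ℕ k) (λ hit → <-irrefl (trans (sym (jIdx-tri m k k≤m)) hit) k<j) ⟩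
    occurrences j (tri m +ℕ k)       ≡⟨ occurrences-row-before j m k (<⇒≤ k<j) (m≤n⇒m≤1+n k≤m) ⟩
    occurrences j (tri m)            ∎
    where open ≡-Reasoning

  occurrences-row-from : ∀ j₀ m k → suc j₀ ≤ k → k ≤ suc m →
    occurrences (suc j₀) (tri m +ℕ k) ≡ suc (occurrences (suc j₀) (tri m))
  occurrences-row-from j₀ m (suc k) (s≤s j₀≤k) (s≤s k≤m) rewrite +-suc (tri m) k
    with m≤n⇒m<n∨m≡n j₀≤k
  ... | inj₂ refl = begin
    occurrences (suc k) (suc (tri m +ℕ k)) ≡⟨ occurrences-hit (suc k) (tri m +ℕ k) (jIdx-tri m k k≤m) ⟩
    suc (occurrences (suc k) (tri m +ℕ k)) ≡⟨ cong suc (occurrences-row-before (suc k) m k ≤-refl (m≤n⇒m≤1+n k≤m)) ⟩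
    suc (occurrences (suc k) (tri m))      ∎
    where open ≡-Reasoning
  ... | inj₁ j₀<k = begin
    occurrences (suc j₀) (suc (tri m +ℕ k)) ≡⟨ occurrences-miss (suc j₀) (tri m +ℕ k) (λ hit → <-irrefl (suc-injective (trans (sym hit) (jIdx-tri m k k≤m))) j₀<k) ⟩
    occurrences (suc j₀) (tri m +ℕ k)       ≡⟨ occurrences-row-from j₀ m k j₀<k (m≤n⇒m≤1+n k≤m) ⟩
    suc (occurrences (suc j₀) (tri m))      ∎
    where open ≡-Reasoning

  occurrences-tri : ∀ j₀ m → occurrences (suc j₀) (tri m) ≡ m ∸ j₀
  occurrences-tri j₀ zero = sym (0∸n≡0 j₀)
  occurrences-tri j₀ (suc m) with j₀ ≤? m
  ... | yes j₀≤m = begin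
    occurrences (suc j₀) (tri (suc m))    ≡⟨ cong (occurrences (suc j₀)) (+-comm (suc m) (tri m)) ⟩
    occurrences (suc j₀) (tri m +ℕ suc m) ≡⟨ occurrences-row-from j₀ m (suc m) (s≤s j₀≤m) ≤-refl ⟩
    suc (occurrences (suc j₀) (tri m))    ≡⟨ cong suc (occurrences-tri j₀ m) ⟩
    suc (m ∸ j₀)                          ≡⟨ +-∸-assoc 1 j₀≤m ⟨
    suc m ∸ j₀                            ∎
    where open ≡-Reasoning
  ... | no j₀≰m = begin
    occurrences (suc j₀) (tri (suc m))    ≡⟨ cong (occurrences (suc j₀)) (+-comm (suc m) (tri m)) ⟩
    occurrences (suc j₀) (tri m +ℕ suc m) ≡⟨ occurrences-row-before (suc j₀) m (suc m) (s≤s m<j₀) ≤-refl ⟩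
    occurrences (suc j₀) (tri m)          ≡⟨ occurrences-tri j₀ m ⟩
    m ∸ j₀                                ≡⟨ m≤n⇒m∸n≡0 (<⇒≤ m<j₀) ⟩
    0                                     ≡⟨ m≤n⇒m∸n≡0 m<j₀ ⟨
    suc m ∸ j₀                            ∎
    where open ≡-Reasoning
          m<j₀ = ≰⇒> j₀≰m

module Derivatives {c ℓ} (R : CommutativeRing c ℓ) where
  open CommutativeRing R
  open Poly R
  open import Algebra.Properties.Group +-group using (x∙y⁻¹≈ε⇒x≈y; x≈y⇒x∙y⁻¹≈ε)
  open import Algebra.Solver.Ring.NaturalCoefficients.Default commutativeSemiring
  module ≈-Reasoning = Relation.Binary.Reasoning.Setoid setoid
  import Data.Nat.Properties as ℕ

  ·ₙ-congʳ : ∀ k {x y} → x ≈ y → k ·ₙ x ≈ k ·ₙ y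
  ·ₙ-congʳ zero x≈y = refl
  ·ₙ-congʳ (suc k) x≈y = +-cong x≈y (·ₙ-congʳ k x≈y)

  ·ₙ-zeroʳ : ∀ k → k ·ₙ 0# ≈ 0#
  ·ₙ-zeroʳ zero = refl
  ·ₙ-zeroʳ (suc k) = trans (+-identityˡ _) (·ₙ-zeroʳ k)

  ·ₙ-distribˡ-+ : ∀ k x y → k ·ₙ (x + y) ≈ k ·ₙ x + k ·ₙ y
  ·ₙ-distribˡ-+ zero x y = sym (+-identityʳ 0#)
  ·ₙ-distribˡ-+ (suc k) x y = trans (+-cong refl (·ₙ-distribˡ-+ k x y))
    (solve 4 (λ x y u v → (x :+ y) :+ (u :+ v) := (x :+ u) :+ (y :+ v)) refl x y (k ·ₙ x) (k ·ₙ y))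

  ·ₙ-comm-* : ∀ k a x → k ·ₙ (a * x) ≈ a * (k ·ₙ x)
  ·ₙ-comm-* zero a x = sym (zeroʳ a)
  ·ₙ-comm-* (suc k) a x = trans (+-cong refl (·ₙ-comm-* k a x)) (sym (distribˡ a x (k ·ₙ x)))

  coeff : ℕ → Pol → Carrier
  coeff k [] = 0#
  coeff zero (b ∷ p) = b
  coeff (suc k) (b ∷ p) = coeff k p

  -- Coefficient lists differing by trailing zeros denote the same polynomial.
  infix 4 _≋_
  record _≋_ (p q : Pol) : Set ℓ where
    constructor mk≋
    field coeff-≈ : ∀ k → coeff k p ≈ coeff k q
  open _≋_

  ≋-refl : ∀ {p} → p ≋ p
  ≋-refl = mk≋ λ _ → refl

  ≋-sym : ∀ {p q} → p ≋ q → q ≋ p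
  ≋-sym p≋q = mk≋ λ k → sym (coeff-≈ p≋q k)

  ≋-trans : ∀ {p q r} → p ≋ q → q ≋ r → p ≋ r
  ≋-trans p≋q q≋r = mk≋ λ k → trans (coeff-≈ p≋q k) (coeff-≈ q≋r k)

  ≋-tail : ∀ {a b p q} → a ∷ p ≋ b ∷ q → p ≋ q
  ≋-tail ap≋bq = mk≋ λ k → coeff-≈ ap≋bq (suc k)

  ≋-setoid : Setoid c ℓ
  ≋-setoid = record
    { Carrier = Pol
    ; _≈_ = _≋_
    ; isEquivalence = record { refl = ≋-refl ; sym = ≋-sym ; trans = ≋-trans }
    }

  module ≋-Reasoning = Relation.Binary.Reasoning.Setoid ≋-setoid

  coeff-+ₚ : ∀ p q k → coeff k (p +ₚ q) ≈ coeff k p + coeff k q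
  coeff-+ₚ [] q k = sym (+-identityˡ _)
  coeff-+ₚ (a ∷ p) [] k = sym (+-identityʳ _)
  coeff-+ₚ (a ∷ p) (b ∷ q) zero = refl
  coeff-+ₚ (a ∷ p) (b ∷ q) (suc k) = coeff-+ₚ p q k

  coeff-scale : ∀ a p k → coeff k (scale a p) ≈ a * coeff k p
  coeff-scale a [] k = sym (zeroʳ a)
  coeff-scale a (b ∷ p) zero = refl
  coeff-scale a (b ∷ p) (suc k) = coeff-scale a p k

  coeff-mulLin-zero : ∀ a p → coeff 0 (mulLin a p) ≈ 0# + - a * coeff 0 p
  coeff-mulLin-zero a p = trans (coeff-+ₚ (0# ∷ p) (scale (- a) p) 0) (+-cong refl (coeff-scale (- a) p 0))

  coeff-mulLin-suc : ∀ a p k → coeff (suc k) (mulLin a p) ≈ coeff k p + - a * coeff (suc k) p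
  coeff-mulLin-suc a p k = trans (coeff-+ₚ (0# ∷ p) (scale (- a) p) (suc k)) (+-cong refl (coeff-scale (- a) p (suc k)))

  coeff-derivFrom : ∀ s p k → coeff k (derivFrom s p) ≈ (s +ℕ k) ·ₙ coeff k p
  coeff-derivFrom s [] k = sym (·ₙ-zeroʳ (s +ℕ k))
  coeff-derivFrom s (b ∷ p) zero rewrite ℕ.+-identityʳ s = refl
  coeff-derivFrom s (b ∷ p) (suc k) rewrite ℕ.+-suc s k = coeff-derivFrom (suc s) p k

  coeff-deriv : ∀ p k → coeff k (deriv p) ≈ suc k ·ₙ coeff (suc k) p
  coeff-deriv [] k = sym (·ₙ-zeroʳ (suc k))
  coeff-deriv (b ∷ p) k = coeff-derivFrom 1 p k

  +ₚ-cong : ∀ {p p′ q q′} → p ≋ p′ → q ≋ q′ → p +ₚ q ≋ p′ +ₚ q′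
  +ₚ-cong {p} {p′} {q} {q′} p≋p′ q≋q′ = mk≋ λ k → begin
    coeff k (p +ₚ q)          ≈⟨ coeff-+ₚ p q k ⟩
    coeff k p + coeff k q     ≈⟨ +-cong (coeff-≈ p≋p′ k) (coeff-≈ q≋q′ k) ⟩
    coeff k p′ + coeff k q′   ≈⟨ coeff-+ₚ p′ q′ k ⟨
    coeff k (p′ +ₚ q′)        ∎
    where open ≈-Reasoning

  deriv-cong : ∀ {p q} → p ≋ q → deriv p ≋ deriv q
  deriv-cong {p} {q} p≋q = mk≋ λ k → begin
    coeff k (deriv p)          ≈⟨ coeff-deriv p k ⟩
    suc k ·ₙ coeff (suc k) p   ≈⟨ ·ₙ-congʳ (suc k) (coeff-≈ p≋q (suc k)) ⟩
    suc k ·ₙ coeff (suc k) q   ≈⟨ coeff-deriv q k ⟨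
    coeff k (deriv q)          ∎
    where open ≈-Reasoning

  deriv-+ₚ : ∀ p q → deriv (p +ₚ q) ≋ deriv p +ₚ deriv q
  deriv-+ₚ p q = mk≋ λ k → begin
    coeff k (deriv (p +ₚ q))                             ≈⟨ coeff-deriv (p +ₚ q) k ⟩
    suc k ·ₙ coeff (suc k) (p +ₚ q)                      ≈⟨ ·ₙ-congʳ (suc k) (coeff-+ₚ p q (suc k)) ⟩
    suc k ·ₙ (coeff (suc k) p + coeff (suc k) q)         ≈⟨ ·ₙ-distribˡ-+ (suc k) _ _ ⟩
    suc k ·ₙ coeff (suc k) p + suc k ·ₙ coeff (suc k) q  ≈⟨ +-cong (coeff-deriv p k) (coeff-deriv q k) ⟨
    coeff k (deriv p) + coeff k (deriv q)                ≈⟨ coeff-+ₚ (deriv p) (deriv q) k ⟨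
    coeff k (deriv p +ₚ deriv q)                         ∎
    where open ≈-Reasoning

  deriv-scale : ∀ a p → deriv (scale a p) ≋ scale a (deriv p)
  deriv-scale a p = mk≋ λ k → begin
    coeff k (deriv (scale a p))         ≈⟨ coeff-deriv (scale a p) k ⟩
    suc k ·ₙ coeff (suc k) (scale a p)  ≈⟨ ·ₙ-congʳ (suc k) (coeff-scale a p (suc k)) ⟩
    suc k ·ₙ (a * coeff (suc k) p)      ≈⟨ ·ₙ-comm-* (suc k) a _ ⟩
    a * (suc k ·ₙ coeff (suc k) p)      ≈⟨ *-cong refl (coeff-deriv p k) ⟨
    a * coeff k (deriv p)               ≈⟨ coeff-scale a (deriv p) k ⟨
    coeff k (scale a (deriv p))         ∎
    where open ≈-Reasoning

  deriv-mulLin : ∀ a p → deriv (mulLin a p) ≋ mulLin a (deriv p) +ₚ p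
  deriv-mulLin a p = mk≋ coeff-≈-deriv-mulLin
    where
    open ≈-Reasoning
    p₀ = coeff 0 p
    p₁ = coeff 1 p
    coeff-≈-deriv-mulLin : ∀ k → coeff k (deriv (mulLin a p)) ≈ coeff k (mulLin a (deriv p) +ₚ p)
    coeff-≈-deriv-mulLin zero = begin
      coeff 0 (deriv (mulLin a p))           ≈⟨ coeff-deriv (mulLin a p) 0 ⟩
      1 ·ₙ coeff 1 (mulLin a p)              ≈⟨ ·ₙ-congʳ 1 (coeff-mulLin-suc a p 0) ⟩
      (p₀ + - a * p₁) + 0#                   ≈⟨ solve 3 (λ p₀ p₁ b → (p₀ :+ b :* p₁) :+ con 0 := (con 0 :+ b :* (p₁ :+ con 0)) :+ p₀) refl p₀ p₁ (- a) ⟩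
      (0# + - a * (1 ·ₙ p₁)) + p₀            ≈⟨ +-cong (+-cong refl (*-cong refl (coeff-deriv p 0))) refl ⟨
      (0# + - a * coeff 0 (deriv p)) + p₀    ≈⟨ +-cong (coeff-mulLin-zero a (deriv p)) refl ⟨
      coeff 0 (mulLin a (deriv p)) + p₀      ≈⟨ coeff-+ₚ (mulLin a (deriv p)) p 0 ⟨
      coeff 0 (mulLin a (deriv p) +ₚ p)      ∎
    coeff-≈-deriv-mulLin (suc k) = begin
      coeff (suc k) (deriv (mulLin a p))                         ≈⟨ coeff-deriv (mulLin a p) (suc k) ⟩
      suc (suc k) ·ₙ coeff (suc (suc k)) (mulLin a p)            ≈⟨ ·ₙ-congʳ (suc (suc k)) (coeff-mulLin-suc a p (suc k)) ⟩
      suc (suc k) ·ₙ (pₖ₊₁ + - a * pₖ₊₂)                         ≈⟨ ·ₙ-distribˡ-+ (suc (suc k)) pₖ₊₁ (- a * pₖ₊₂) ⟩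
      (pₖ₊₁ + suc k ·ₙ pₖ₊₁) + suc (suc k) ·ₙ (- a * pₖ₊₂)       ≈⟨ +-cong refl (·ₙ-comm-* (suc (suc k)) (- a) pₖ₊₂) ⟩
      (pₖ₊₁ + suc k ·ₙ pₖ₊₁) + - a * (suc (suc k) ·ₙ pₖ₊₂)       ≈⟨ solve 3 (λ x u v → (x :+ u) :+ v := (u :+ v) :+ x) refl pₖ₊₁ _ _ ⟩
      (suc k ·ₙ pₖ₊₁ + - a * (suc (suc k) ·ₙ pₖ₊₂)) + pₖ₊₁       ≈⟨ +-cong (+-cong (coeff-deriv p k) (*-cong refl (coeff-deriv p (suc k)))) refl ⟨
      (coeff k (deriv p) + - a * coeff (suc k) (deriv p)) + pₖ₊₁ ≈⟨ +-cong (coeff-mulLin-suc a (deriv p) k) refl ⟨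
      coeff (suc k) (mulLin a (deriv p)) + pₖ₊₁                  ≈⟨ coeff-+ₚ (mulLin a (deriv p)) p (suc k) ⟨
      coeff (suc k) (mulLin a (deriv p) +ₚ p)                    ∎
      where pₖ₊₁ = coeff (suc k) p
            pₖ₊₂ = coeff (suc (suc k)) p

  scale-identity : ∀ {a} → a ≈ 1# → ∀ p → scale a p ≋ p
  scale-identity a≈1 p = mk≋ λ k → trans (coeff-scale _ p k) (trans (*-cong a≈1 refl) (*-identityˡ _))

  +ₚ-scale-absorb : ∀ q r a → (q +ₚ r) +ₚ scale a r ≋ q +ₚ scale (1# + a) r
  +ₚ-scale-absorb q r a = mk≋ λ k → begin
    coeff k ((q +ₚ r) +ₚ scale a r)               ≈⟨ coeff-+ₚ (q +ₚ r) (scale a r) k ⟩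
    coeff k (q +ₚ r) + coeff k (scale a r)        ≈⟨ +-cong (coeff-+ₚ q r k) (coeff-scale a r k) ⟩
    (coeff k q + coeff k r) + a * coeff k r       ≈⟨ solve 3 (λ x y a → (x :+ y) :+ a :* y := x :+ (con 1 :+ a) :* y) refl (coeff k q) (coeff k r) a ⟩
    coeff k q + (1# + a) * coeff k r              ≈⟨ +-cong refl (coeff-scale (1# + a) r k) ⟨
    coeff k q + coeff k (scale (1# + a) r)        ≈⟨ coeff-+ₚ q (scale (1# + a) r) k ⟨
    coeff k (q +ₚ scale (1# + a) r)               ∎
    where open ≈-Reasoning

  derivN-mulLin : ∀ a i p →
    derivN (suc i) (mulLin a p) ≋ mulLin a (derivN (suc i) p) +ₚ scale (suc i ·ₙ 1#) (derivN i p)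
  derivN-mulLin a zero p = begin
    deriv (mulLin a p)                      ≈⟨ deriv-mulLin a p ⟩
    mulLin a (deriv p) +ₚ p                 ≈⟨ +ₚ-cong ≋-refl (scale-identity (+-identityʳ 1#) p) ⟨
    mulLin a (deriv p) +ₚ scale (1# + 0#) p ∎
    where open ≋-Reasoning
  derivN-mulLin a (suc i) p = begin
    deriv (derivN (suc i) (mulLin a p))          ≈⟨ deriv-cong (derivN-mulLin a i p) ⟩
    deriv (mulLin a D +ₚ scale n D′)             ≈⟨ deriv-+ₚ (mulLin a D) (scale n D′) ⟩
    deriv (mulLin a D) +ₚ deriv (scale n D′)     ≈⟨ +ₚ-cong (deriv-mulLin a D) (deriv-scale n D′) ⟩
    (mulLin a (deriv D) +ₚ D) +ₚ scale n D       ≈⟨ +ₚ-scale-absorb (mulLin a (deriv D)) D n ⟩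
    mulLin a (deriv D) +ₚ scale (1# + n) D       ∎
    where open ≋-Reasoning
          D′ = derivN i p
          D = derivN (suc i) p
          n = suc i ·ₙ 1#

  eval-[]≋ : ∀ {q} → [] ≋ q → ∀ x → eval q x ≈ 0#
  eval-[]≋ {[]} _ x = refl
  eval-[]≋ {b ∷ q} []≋q x = begin
    b + x * eval q x  ≈⟨ +-cong (sym (coeff-≈ []≋q 0)) (*-cong refl (eval-[]≋ {q} (mk≋ λ k → coeff-≈ []≋q (suc k)) x)) ⟩
    0# + x * 0#       ≈⟨ +-identityˡ _ ⟩
    x * 0#            ≈⟨ zeroʳ x ⟩
    0#                ∎
    where open ≈-Reasoning

  eval-cong : ∀ {p q} → p ≋ q → ∀ x → eval p x ≈ eval q x
  eval-cong {[]} []≋q x = sym (eval-[]≋ []≋q x)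
  eval-cong {a ∷ p} {[]} p≋[] x = eval-[]≋ (≋-sym p≋[]) x
  eval-cong {a ∷ p} {b ∷ q} p≋q x =
    +-cong (coeff-≈ p≋q 0) (*-cong refl (eval-cong (≋-tail p≋q) x))

  eval-+ₚ : ∀ p q x → eval (p +ₚ q) x ≈ eval p x + eval q x
  eval-+ₚ [] q x = sym (+-identityˡ _)
  eval-+ₚ (a ∷ p) [] x = sym (+-identityʳ _)
  eval-+ₚ (a ∷ p) (b ∷ q) x = trans (+-cong refl (*-cong refl (eval-+ₚ p q x)))
    (solve 5 (λ a b x u v → (a :+ b) :+ x :* (u :+ v) := (a :+ x :* u) :+ (b :+ x :* v)) refl a b x (eval p x) (eval q x))

  eval-scale : ∀ a p x → eval (scale a p) x ≈ a * eval p x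
  eval-scale a [] x = sym (zeroʳ a)
  eval-scale a (b ∷ p) x = trans (+-cong refl (*-cong refl (eval-scale a p x)))
    (solve 4 (λ a b x u → a :* b :+ x :* (a :* u) := a :* (b :+ x :* u)) refl a b x (eval p x))

  eval-mulLin : ∀ a p x → eval (mulLin a p) x ≈ (x + - a) * eval p x
  eval-mulLin a p x = begin
    eval ((0# ∷ p) +ₚ scale (- a) p) x         ≈⟨ eval-+ₚ (0# ∷ p) (scale (- a) p) x ⟩
    (0# + x * eval p x) + eval (scale (- a) p) x ≈⟨ +-cong (+-identityˡ _) (eval-scale (- a) p x) ⟩
    x * eval p x + - a * eval p x              ≈⟨ distribʳ (eval p x) x (- a) ⟨
    (x + - a) * eval p x                       ∎
    where open ≈-Reasoning

  derivAt : ℕ → Pol → Carrier → Carrier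
  derivAt i p x = eval (derivN i p) x

  derivAt-mulLin : ∀ a i p x →
    derivAt (suc i) (mulLin a p) x ≈ (x + - a) * derivAt (suc i) p x + (suc i ·ₙ 1#) * derivAt i p x
  derivAt-mulLin a i p x = begin
    eval (derivN (suc i) (mulLin a p)) x                                   ≈⟨ eval-cong (derivN-mulLin a i p) x ⟩
    eval (mulLin a (derivN (suc i) p) +ₚ scale (suc i ·ₙ 1#) (derivN i p)) x ≈⟨ eval-+ₚ (mulLin a (derivN (suc i) p)) (scale (suc i ·ₙ 1#) (derivN i p)) x ⟩
    eval (mulLin a (derivN (suc i) p)) x + eval (scale (suc i ·ₙ 1#) (derivN i p)) x
      ≈⟨ +-cong (eval-mulLin a (derivN (suc i) p) x) (eval-scale (suc i ·ₙ 1#) (derivN i p) x) ⟩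
    (x + - a) * derivAt (suc i) p x + (suc i ·ₙ 1#) * derivAt i p x        ∎
    where open ≈-Reasoning

  x≈0⇒xy≈0 : ∀ {x} y → x ≈ 0# → x * y ≈ 0#
  x≈0⇒xy≈0 y x≈0 = trans (*-cong x≈0 refl) (zeroˡ y)

  y≈0⇒xy≈0 : ∀ x {y} → y ≈ 0# → x * y ≈ 0#
  y≈0⇒xy≈0 x y≈0 = trans (*-cong refl y≈0) (zeroʳ x)

  x≉0∧y≉0⇒xy≉0 : IntegralDomain → ∀ {x y} → ¬ x ≈ 0# → ¬ y ≈ 0# → ¬ x * y ≈ 0#
  x≉0∧y≉0⇒xy≉0 domain x≉0 y≉0 xy≈0 with domain _ _ xy≈0
  ... | inj₁ x≈0 = x≉0 x≈0
  ... | inj₂ y≈0 = y≉0 y≈0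

  HasRootOfOrder : ℕ → Pol → Carrier → Set ℓ
  HasRootOfOrder k p x = (∀ i → i < k → derivAt i p x ≈ 0#) × ¬ derivAt k p x ≈ 0#

  root-order-one : CharZero → ∀ x → HasRootOfOrder 0 (1# ∷ []) x
  root-order-one char0 x = (λ _ ()) , λ 1+x0≈0 → char0 0 (trans (+-cong refl (sym (zeroʳ x))) 1+x0≈0)

  root-order-mulLin-root : IntegralDomain → CharZero → ∀ {k p x b} → b ≈ x →
    HasRootOfOrder k p x → HasRootOfOrder (suc k) (mulLin b p) x
  root-order-mulLin-root domain char0 {k} {p} {x} {b} b≈x (vanish , nonvanish) = vanish′ , nonvanish′
    where
    x-b≈0 : x + - b ≈ 0#
    x-b≈0 = x≈y⇒x∙y⁻¹≈ε (sym b≈x)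
    vanish′ : ∀ i → i < suc k → derivAt i (mulLin b p) x ≈ 0#
    vanish′ zero _ = trans (eval-mulLin b p x) (x≈0⇒xy≈0 _ x-b≈0)
    vanish′ (suc i) (s≤s i<k) = trans (derivAt-mulLin b i p x)
      (trans (+-cong (x≈0⇒xy≈0 _ x-b≈0) (y≈0⇒xy≈0 _ (vanish i i<k))) (+-identityʳ 0#))
    nonvanish′ : ¬ derivAt (suc k) (mulLin b p) x ≈ 0#
    nonvanish′ d≈0 = x≉0∧y≉0⇒xy≉0 domain (char0 k) nonvanish (begin
      (suc k ·ₙ 1#) * derivAt k p x                                      ≈⟨ +-identityˡ _ ⟨
      0# + (suc k ·ₙ 1#) * derivAt k p x                                 ≈⟨ +-cong (x≈0⇒xy≈0 _ x-b≈0) refl ⟨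
      (x + - b) * derivAt (suc k) p x + (suc k ·ₙ 1#) * derivAt k p x    ≈⟨ derivAt-mulLin b k p x ⟨
      derivAt (suc k) (mulLin b p) x                                     ≈⟨ d≈0 ⟩
      0#                                                                 ∎)
      where open ≈-Reasoning

  root-order-mulLin-nonroot : IntegralDomain → ∀ {k p x b} → ¬ b ≈ x →
    HasRootOfOrder k p x → HasRootOfOrder k (mulLin b p) x
  root-order-mulLin-nonroot domain {k} {p} {x} {b} b≉x (vanish , nonvanish) = vanish′ , nonvanish′ k vanish nonvanish
    where
    x-b≉0 : ¬ x + - b ≈ 0#
    x-b≉0 x-b≈0 = b≉x (sym (x∙y⁻¹≈ε⇒x≈y x b x-b≈0))
    vanish′ : ∀ i → i < k → derivAt i (mulLin b p) x ≈ 0#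
    vanish′ zero 0<k = trans (eval-mulLin b p x) (y≈0⇒xy≈0 _ (vanish 0 0<k))
    vanish′ (suc i) i+1<k = trans (derivAt-mulLin b i p x)
      (trans (+-cong (y≈0⇒xy≈0 _ (vanish (suc i) i+1<k)) (y≈0⇒xy≈0 _ (vanish i (ℕ.<-trans (ℕ.n<1+n i) i+1<k))))
        (+-identityʳ 0#))
    nonvanish′ : ∀ k → (∀ i → i < k → derivAt i p x ≈ 0#) → ¬ derivAt k p x ≈ 0# →
      ¬ derivAt k (mulLin b p) x ≈ 0#
    nonvanish′ zero _ d≉0 d′≈0 = x≉0∧y≉0⇒xy≉0 domain x-b≉0 d≉0 (trans (sym (eval-mulLin b p x)) d′≈0)
    nonvanish′ (suc k) vanish d≉0 d′≈0 = x≉0∧y≉0⇒xy≉0 domain x-b≉0 d≉0 (begin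
      (x + - b) * derivAt (suc k) p x                                    ≈⟨ +-identityʳ _ ⟨
      (x + - b) * derivAt (suc k) p x + 0#                               ≈⟨ +-cong refl (y≈0⇒xy≈0 _ (vanish k (ℕ.n<1+n k))) ⟨
      (x + - b) * derivAt (suc k) p x + (suc k ·ₙ 1#) * derivAt k p x    ≈⟨ derivAt-mulLin b k p x ⟨
      derivAt (suc k) (mulLin b p) x                                     ≈⟨ d′≈0 ⟩
      0#                                                                 ∎)
      where open ≈-Reasoning

  module _ (domain : IntegralDomain) (char0 : CharZero) (α : ℕ → Carrier) (distinct : PairwiseDistinct α)
           (j : ℕ) (1≤j : 1 ≤ j) where
    open Enumeration using (occurrences; jIdx-pos)

    root-order-P : ∀ l → HasRootOfOrder (occurrences j l) (P α l) (α j)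
    root-order-P zero = root-order-one char0 (α j)
    root-order-P (suc l) with jIdx (suc l) ≟ j
    ... | yes hit = root-order-mulLin-root domain char0 (reflexive (≡.cong α hit)) (root-order-P l)
    ... | no miss = root-order-mulLin-nonroot domain (distinct _ _ (jIdx-pos l) 1≤j miss) (root-order-P l)

lemma2 : ∀ {c ℓ} (R : CommutativeRing c ℓ) →
    let open CommutativeRing R
        open Poly R
    in IntegralDomain → CharZero →
       (α : ℕ → Carrier) → PairwiseDistinct α →
       ∀ n m j → 1 ≤ j → j ≤ suc m → n ≡ tri m +ℕ j →
       ¬ (eval (derivN (suc m ∸ j) (P α (n ∸ 1))) (α j) ≈ 0#)
       × (∀ l → n ≤ l → eval (derivN (suc m ∸ j) (P α l)) (α j) ≈ 0#)
lemma2 R domain char0 α distinct n m (suc j₀) 1≤j (s≤s j₀≤m) ≡.refl = nonvanishing , vanishing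
  where
  open CommutativeRing R using (_≈_; 0#)
  open Poly R using (P)
  open Derivatives R
  open Enumeration
  open import Data.Nat.Properties using (≤-refl; m≤n⇒m≤1+n; +-suc)
  order : ∀ l → HasRootOfOrder (occurrences (suc j₀) l) (P α l) (α (suc j₀))
  order = root-order-P domain char0 α distinct (suc j₀) 1≤j
  occurrences-before : occurrences (suc j₀) (tri m +ℕ j₀) ≡ m ∸ j₀
  occurrences-before = ≡.trans (occurrences-row-before (suc j₀) m j₀ ≤-refl (m≤n⇒m≤1+n j₀≤m)) (occurrences-tri j₀ m)
  occurrences-at : occurrences (suc j₀) (tri m +ℕ suc j₀) ≡ suc (m ∸ j₀)
  occurrences-at = ≡.trans (occurrences-row-from j₀ m (suc j₀) ≤-refl (s≤s j₀≤m)) (≡.cong suc (occurrences-tri j₀ m))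
  nonvanishing : ¬ derivAt (m ∸ j₀) (P α (tri m +ℕ suc j₀ ∸ 1)) (α (suc j₀)) ≈ 0#
  nonvanishing rewrite +-suc (tri m) j₀ | ≡.sym occurrences-before = proj₂ (order (tri m +ℕ j₀))
  vanishing : ∀ l → tri m +ℕ suc j₀ ≤ l → derivAt (m ∸ j₀) (P α l) (α (suc j₀)) ≈ 0#
  vanishing l n≤l = proj₁ (order l) (m ∸ j₀)
    (≡.subst (_≤ occurrences (suc j₀) l) occurrences-at (occurrences-mono (suc j₀) n≤l))
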